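{- Let $\mathbb F_q$ be a finite field, $\Gamma\subseteq\mathbb F_q^*$ a multiplicative subgroup and $\Gamma_*=\xi\Gamma$ a coset of $\Gamma$ ($\xi\in\mathbb F_q^*$). Let $Q\subseteq\mathbb F_q$ be a nonempty $\Gamma$-invariant set (i.e. $\gamma Q=Q$ for all $\gamma\in\Gamma$). Then for every nonempty $\Gamma'\subseteq\Gamma_*$, $$|Q+\Gamma'|\ge|\Gamma'|\cdot\frac{|\Gamma||Q|^2}{\mathsf E_2(\Gamma_*,Q)}.$$ If $k\ge1$ and $Q^{(y)}\subseteq Q^k$ ($y\in\Gamma'$) is an arbitrary family of sets, then for either choice of sign $$\Big|\bigcup_{y\in\Gamma'}\big(Q^{(y)}\pm\Delta(y)\big)\Big|\ge\frac{|\Gamma|}{|\Gamma'|\,\mathsf E_{k+1}(\Gamma_*,Q)}\Big(\sum_{y\in\Gamma'}|Q^{(y)}|\Big)^2.$$ Furthermore, for each $k\ge2$, $$R^{(k)}_Q[\Gamma_*]\ge\frac{|\Gamma||Q|^{2k}}{\mathsf E_{k+1}(\Gamma_*,Q)}.$$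
   Context: Everything is in the additive group of $\mathbb F_q$. $(X\circ X)(x)=|\{y\in X:y+x\in X\}|$ and $\mathsf E_j(X,Y)=\sum_x(X\circ X)(x)(Y\circ Y)(x)^{j-1}$. $\Delta(y)=(y,\dots,y)\in\mathbb F_q^k$, $U\pm\Delta(y)=\{u\pm\Delta(y):u\in U\}$. $R^{(k)}_Q[A]=\min_{\emptyset\ne Z\subseteq A}|Q^k+\Delta(Z)|/|Z|$ with $Q^k+\Delta(Z)=\{(x_1+z,\dots,x_k+z):x_i\in Q,z\in Z\}$. -}

module Defs where

open import Level using (0ℓ)
open import Data.Bool using (Bool; true; false; _∧_; _∨_; if_then_else_)
open import Data.Nat using (ℕ; zero; suc; _^_; _∸_) renaming (_+_ to _+ℕ_; _*_ to _*ℕ_)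
open import Data.List using (List; []; _∷_; map; concatMap)
open import Data.Nat.ListAction using (sum)
open import Data.Bool.ListAction using (any)
open import Data.List.Membership.Propositional using (_∈_)
open import Data.List.Relation.Unary.Unique.Propositional using (Unique)
open import Data.Vec using (Vec; []; _∷_; replicate; zipWith; toList)
open import Data.Vec.Relation.Unary.All using (All)
open import Data.Product using (∃; Σ; _×_)
open import Data.Sign using (Sign)
open import Relation.Nullary using (¬_)
open import Relation.Nullary.Decidable using (⌊_⌋)
open import Relation.Binary.Definitions using (DecidableEquality)
open import Relation.Binary.PropositionalEquality using (_≡_)
open import Algebra.Structures using (IsCommutativeRing)

record FiniteField : Set₁ where
  infixl 6 _+_
  infixl 7 _*_
  infix 4 _≟_
  field
    F     : Set
    _+_   : F → F → F
    _*_   : F → F → F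
    -_    : F → F
    0#    : F
    1#    : F
    isCommutativeRing : IsCommutativeRing _≡_ _+_ _*_ -_ 0# 1#
    0≢1   : ¬ (0# ≡ 1#)
    inverse : ∀ x → ¬ (x ≡ 0#) → ∃ λ y → x * y ≡ 1#
    _≟_   : DecidableEquality F
    elements : List F
    complete : ∀ x → x ∈ elements
    unique   : Unique elements

module FF (𝔽 : FiniteField) where
  -- the field operations are opened privately so that they do not clash
  -- with the ℕ operations used in the statement
  open FiniteField 𝔽 public using (F; 0#; 1#; elements)
  open FiniteField 𝔽 using (_+_; _*_; -_; _≟_)

  private
    infixl 6 _-_
    _-_ : F → F → F
    x - y = x + (- y)

  Subset : Set
  Subset = F → Bool

  VSubset : ℕ → Set
  VSubset k = Vec F k → Bool

  _⊆_ : Subset → Subset → Set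
  X ⊆ Y = ∀ x → X x ≡ true → Y x ≡ true

  Nonempty : Subset → Set
  Nonempty X = ∃ λ x → X x ≡ true

  ΣF : (F → ℕ) → ℕ
  ΣF f = sum (map f elements)

  ind : Bool → ℕ
  ind true  = 1
  ind false = 0

  ∣_∣ : Subset → ℕ
  ∣ X ∣ = ΣF (λ x → ind (X x))

  allVecs : (k : ℕ) → List (Vec F k)
  allVecs zero    = [] ∷ []
  allVecs (suc k) = concatMap (λ x → map (x ∷_) (allVecs k)) elements

  ∣_∣ᵛ : ∀ {k} → VSubset k → ℕ
  ∣_∣ᵛ {k} V = sum (map (λ v → ind (V v)) (allVecs k))

  record IsMulSubgroup (Γ : Subset) : Set where
    field
      zero∉ : Γ 0# ≡ false
      one∈  : Γ 1# ≡ true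
      mul∈  : ∀ x y → Γ x ≡ true → Γ y ≡ true → Γ (x * y) ≡ true
      inv∈  : ∀ x y → Γ x ≡ true → x * y ≡ 1# → Γ y ≡ true

  scale : F → Subset → Subset
  scale ξ X x = any (λ g → X g ∧ ⌊ x ≟ ξ * g ⌋) elements

  GammaInvariant : Subset → Subset → Set
  GammaInvariant Γ Q = ∀ γ → Γ γ ≡ true → ∀ x → scale γ Q x ≡ Q x

  _⊕_ : Subset → Subset → Subset
  (X ⊕ Y) x = any (λ y → Y y ∧ X (x - y)) elements

  conv : Subset → F → ℕ
  conv X x = ∣ (λ y → X y ∧ X (y + x)) ∣

  E : ℕ → Subset → Subset → ℕ
  E j X Y = ΣF (λ x → conv X x *ℕ (conv Y x ^ (j ∸ 1)))

  Δ : (k : ℕ) → F → Vec F k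
  Δ k y = replicate k y

  -- v ∓ Δ(y) according to the sign (used to test membership in U ± Δ(y))
  unshift : ∀ {k} → Sign → Vec F k → F → Vec F k
  unshift {k} Sign.+ v y = zipWith _-_ v (Δ k y)
  unshift {k} Sign.- v y = zipWith _+_ v (Δ k y)

  unionShift : ∀ {k} → Sign → Subset → (F → VSubset k) → VSubset k
  unionShift s Γ' Qf v = any (λ y → Γ' y ∧ Qf y (unshift s v y)) elements

  allB : ∀ {k} → (F → Bool) → Vec F k → Bool
  allB P []       = true
  allB P (x ∷ v)  = P x ∧ allB P v

  _⊆Pow_ : ∀ {k} → VSubset k → Subset → Set
  U ⊆Pow Q = ∀ v → U v ≡ true → All (λ c → Q c ≡ true) v

  powPlusΔ : (k : ℕ) → Subset → Subset → VSubset k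
  powPlusΔ k Q Z v = any (λ z → Z z ∧ allB (λ c → Q (c - z)) v) elements

-- Write C(d) = (Q∘Q)(d), Γ* = ξΓ, and fix a sign s and a family Q^(y) ⊆ Q^k
-- indexed by y ∈ Γ' ⊆ Γ*.  Let r(v) be the number of y ∈ Γ' with
-- v ∈ Q^(y) ± Δ(y), and U the union of these translates.  Then
--   (1) Σ_v r(v) = Σ_y |Q^(y)|                       (translation invariance);
--   (2) (Σ_v r(v))² ≤ |U| · Σ_v r(v)²                 (Cauchy–Schwarz, r = 0 off U);
--   (3) Σ_v r(v)² ≤ Σ_{y,y' ∈ Γ'} C(y' - y)^k          (because Q^(y) ⊆ Q^k);
--   (4) |Γ| · Σ_{y,y' ∈ Γ'} C(y' - y)^k ≤ |Γ'| · E_{k+1}(Γ*, Q).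
-- For (4): C is Γ-invariant because Q is, so the row sum Σ_{y' ∈ Γ*} C(y' - y)^k
-- is constant on the coset Γ*, and |Γ| copies of it make up E_{k+1}(Γ*, Q).
-- Chaining (1)–(4) gives the second inequality; the first and third are its
-- cases Q^(y) = Q (k = 1) and Q^(y) = Q^k, after cancelling |Γ'| resp. |Z|.

module Submission where

open import Defs
open import Data.Nat using (ℕ; suc; _≤_; _*_; _^_; _+_; _∸_; z≤n; >-nonZero)
open import Data.Nat.Properties
  using ( +-comm; +-identityʳ; *-assoc; *-comm; *-identityʳ; *-zeroʳ
        ; *-distribˡ-+; +-mono-≤; *-mono-≤; *-monoʳ-≤; *-monoˡ-≤; *-cancelˡ-≤
        ; ≤-refl; ≤-trans; ≤-reflexive; ≤-total; m≤m+n; m≤n+m; m+[n∸m]≡n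
        ; m+n∸n≡m; ^-distribˡ-+-*; [m*n]*[o*p]≡[m*o]*[n*p]
        ; +-commutativeSemigroup; *-commutativeSemigroup; module ≤-Reasoning )
open import Data.Nat.Tactic.RingSolver using (solve-∀)
open import Data.Nat.ListAction using (sum)
open import Data.Nat.ListAction.Properties using (sum-++)
open import Data.Bool using (Bool; true; false; _∧_; _∨_; if_then_else_)
open import Data.Bool.Properties using (∧-comm; ∧-identityʳ)
open import Data.Bool.ListAction using (any)
open import Data.List using (List; []; _∷_; map; concatMap; _++_)
open import Data.List.Properties using (map-cong; map-++)
open import Data.List.Membership.Propositional using (_∈_)
open import Data.List.Relation.Unary.Any using (here; there)
import Data.List.Relation.Unary.All as ListAll
open import Data.List.Relation.Unary.AllPairs using (_∷_)
open import Data.List.Relation.Unary.Unique.Propositional using (Unique)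
open import Data.Vec using (Vec; []; _∷_; zipWith)
open import Data.Vec.Relation.Unary.All using (All; []; _∷_)
open import Data.Product using (∃; _×_; _,_; proj₁; proj₂)
open import Data.Sum using (inj₁; inj₂)
open import Data.Sign using (Sign)
open import Data.Empty using (⊥-elim)
open import Relation.Nullary using (¬_; yes; no)
open import Relation.Nullary.Decidable using (⌊_⌋)
open import Relation.Binary.PropositionalEquality
open import Algebra.Bundles using (CommutativeRing)
import Algebra.Properties.Ring as RingProperties
open import Algebra.Properties.CommutativeSemigroup +-commutativeSemigroup
  using () renaming (interchange to +-interchange)
open import Algebra.Properties.CommutativeSemigroup *-commutativeSemigroup
  using () renaming (x∙yz≈y∙xz to *-left-swap)

module FiniteSums where

  private variable A B : Set

  ∑ : List A → (A → ℕ) → ℕ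
  ∑ xs f = sum (map f xs)

  ∑-cong : ∀ xs {f g : A → ℕ} → (∀ x → f x ≡ g x) → ∑ xs f ≡ ∑ xs g
  ∑-cong xs e = cong sum (map-cong e xs)

  ∑-mono : ∀ xs {f g : A → ℕ} → (∀ x → f x ≤ g x) → ∑ xs f ≤ ∑ xs g
  ∑-mono []       e = z≤n
  ∑-mono (x ∷ xs) e = +-mono-≤ (e x) (∑-mono xs e)

  ∑-zero : ∀ (xs : List A) → ∑ xs (λ _ → 0) ≡ 0
  ∑-zero []       = refl
  ∑-zero (x ∷ xs) = ∑-zero xs

  ∑-+ : ∀ xs (f g : A → ℕ) → ∑ xs (λ x → f x + g x) ≡ ∑ xs f + ∑ xs g
  ∑-+ []       f g = refl
  ∑-+ (x ∷ xs) f g =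
    trans (cong (f x + g x +_) (∑-+ xs f g)) (+-interchange (f x) (g x) _ _)

  ∑-*ˡ : ∀ xs c (f : A → ℕ) → ∑ xs (λ x → c * f x) ≡ c * ∑ xs f
  ∑-*ˡ []       c f = sym (*-zeroʳ c)
  ∑-*ˡ (x ∷ xs) c f =
    trans (cong (c * f x +_) (∑-*ˡ xs c f)) (sym (*-distribˡ-+ c (f x) _))

  ∑-*ʳ : ∀ xs c (f : A → ℕ) → ∑ xs (λ x → f x * c) ≡ ∑ xs f * c
  ∑-*ʳ xs c f =
    trans (∑-cong xs (λ x → *-comm (f x) c)) (trans (∑-*ˡ xs c f) (*-comm c _))

  ∑-++ : ∀ xs ys (f : A → ℕ) → ∑ (xs ++ ys) f ≡ ∑ xs f + ∑ ys f
  ∑-++ xs ys f = trans (cong sum (map-++ f xs ys)) (sum-++ (map f xs) (map f ys))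

  ∑-map : ∀ xs (h : A → B) (f : B → ℕ) → ∑ (map h xs) f ≡ ∑ xs (λ x → f (h x))
  ∑-map []       h f = refl
  ∑-map (x ∷ xs) h f = cong (f (h x) +_) (∑-map xs h f)

  ∑-concatMap : ∀ xs (g : A → List B) (f : B → ℕ) →
                ∑ (concatMap g xs) f ≡ ∑ xs (λ x → ∑ (g x) f)
  ∑-concatMap []       g f = refl
  ∑-concatMap (x ∷ xs) g f =
    trans (∑-++ (g x) _ f) (cong (∑ (g x) f +_) (∑-concatMap xs g f))

  ∑-swap : ∀ xs ys (f : A → B → ℕ) →
           ∑ xs (λ x → ∑ ys (f x)) ≡ ∑ ys (λ y → ∑ xs (λ x → f x y))
  ∑-swap []       ys f = sym (∑-zero ys)
  ∑-swap (x ∷ xs) ys f =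
    trans (cong (∑ ys (f x) +_) (∑-swap xs ys f)) (sym (∑-+ ys (f x) _))

  ∑-product : ∀ xs ys (f : A → ℕ) (g : B → ℕ) →
              ∑ xs f * ∑ ys g ≡ ∑ xs (λ x → ∑ ys (λ y → f x * g y))
  ∑-product xs ys f g =
    trans (sym (∑-*ʳ xs (∑ ys g) f)) (∑-cong xs (λ x → sym (∑-*ˡ ys (f x) g)))

  ∑-≤-member : ∀ xs (f : A → ℕ) {x} → x ∈ xs → f x ≤ ∑ xs f
  ∑-≤-member (y ∷ xs) f (here refl) = m≤m+n _ _
  ∑-≤-member (y ∷ xs) f (there m)   = ≤-trans (∑-≤-member xs f m) (m≤n+m _ _)

  -- 2pq ≤ p² + q², first for p ≤ q (write q = p + d), then in general.
  two-products-ordered : ∀ {p q} → p ≤ q → 2 * (p * q) ≤ p * p + q * q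
  two-products-ordered {p} {q} p≤q =
    subst (λ t → 2 * (p * t) ≤ p * p + t * t) (m+[n∸m]≡n p≤q)
      (subst (2 * (p * (p + (q ∸ p))) ≤_) (square-identity p (q ∸ p)) (m≤m+n _ _))
    where
      square-identity : ∀ p d → 2 * (p * (p + d)) + d * d ≡ p * p + (p + d) * (p + d)
      square-identity = solve-∀

  two-products≤squares : ∀ p q → 2 * (p * q) ≤ p * p + q * q
  two-products≤squares p q with ≤-total p q
  ... | inj₁ p≤q = two-products-ordered p≤q
  ... | inj₂ q≤p = subst₂ _≤_ (cong (2 *_) (*-comm q p)) (+-comm (q * q) (p * p))
                          (two-products-ordered q≤p)

  -- Cauchy–Schwarz: (Σ aᵢbᵢ)² ≤ (Σ aᵢ²)(Σ bᵢ²).  Expanding both sides as double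
  -- sums, it is the sum over pairs (x,y) of 2(aₓbₓ)(a_yb_y) ≤ (aₓb_y)² + (a_ybₓ)².
  cauchy-schwarz : ∀ {A : Set} (xs : List A) (a b : A → ℕ) →
    ∑ xs (λ x → a x * b x) * ∑ xs (λ x → a x * b x)
      ≤ ∑ xs (λ x → a x * a x) * ∑ xs (λ x → b x * b x)
  cauchy-schwarz {A} xs a b = *-cancelˡ-≤ 2 (begin
    2 * (∑ xs ab * ∑ xs ab)
      ≡⟨ cong (2 *_) (∑-product xs xs ab ab) ⟩
    2 * ∑ xs (λ x → ∑ xs (λ y → ab x * ab y))
      ≡⟨ sym (trans (∑-cong xs (λ x → ∑-*ˡ xs 2 _)) (∑-*ˡ xs 2 _)) ⟩
    ∑ xs (λ x → ∑ xs (λ y → 2 * (ab x * ab y)))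
      ≤⟨ ∑-mono xs (λ x → ∑-mono xs (λ y → pointwise x y)) ⟩
    ∑ xs (λ x → ∑ xs (λ y → aa x * bb y + aa y * bb x))
      ≡⟨ trans (∑-cong xs (λ x → ∑-+ xs _ _)) (∑-+ xs _ _) ⟩
    ∑ xs (λ x → ∑ xs (λ y → aa x * bb y)) + ∑ xs (λ x → ∑ xs (λ y → aa y * bb x))
      ≡⟨ cong (∑ xs (λ x → ∑ xs (λ y → aa x * bb y)) +_) (∑-swap xs xs (λ x y → aa y * bb x)) ⟩
    ∑ xs (λ x → ∑ xs (λ y → aa x * bb y)) + ∑ xs (λ x → ∑ xs (λ y → aa x * bb y))
      ≡⟨ cong (λ t → t + t) (sym (∑-product xs xs aa bb)) ⟩
    ∑ xs aa * ∑ xs bb + ∑ xs aa * ∑ xs bb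
      ≡⟨ cong (∑ xs aa * ∑ xs bb +_) (sym (+-identityʳ (∑ xs aa * ∑ xs bb))) ⟩
    2 * (∑ xs aa * ∑ xs bb) ∎)
    where
      open ≤-Reasoning
      ab aa bb : A → ℕ
      ab x = a x * b x
      aa x = a x * a x
      bb x = b x * b x
      pointwise : ∀ x y → 2 * (ab x * ab y) ≤ aa x * bb y + aa y * bb x
      pointwise x y = subst₂ _≤_ (cong (2 *_) (regroup (a x) (b x) (a y) (b y)))
        (cong₂ _+_ (square (a x) (b y)) (square (a y) (b x)))
        (two-products≤squares (a x * b y) (a y * b x))
        where
          regroup : ∀ p q r s → (p * s) * (r * q) ≡ (p * q) * (r * s)
          regroup = solve-∀
          square : ∀ p q → (p * q) * (p * q) ≡ (p * p) * (q * q)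
          square = solve-∀

  cauchy-schwarz-support : ∀ (xs : List A) (w r : A → ℕ) →
    (∀ x → w x * w x ≡ w x) → (∀ x → w x * r x ≡ r x) →
    ∑ xs r * ∑ xs r ≤ ∑ xs w * ∑ xs (λ x → r x * r x)
  cauchy-schwarz-support xs w r idem supp =
    subst₂ (λ s t → s * s ≤ t * ∑ xs (λ x → r x * r x))
      (∑-cong xs supp) (∑-cong xs idem) (cauchy-schwarz xs w r)

module FieldSums (𝔽 : FiniteField) where

  open FiniteSums
  open FF 𝔽 public
  open FiniteField 𝔽 public
    using (_≟_; complete; unique; inverse)
    renaming (_+_ to _+F_; _*_ to _*F_; -_ to -F_)
  open FiniteField 𝔽 using (isCommutativeRing)

  fieldRing : CommutativeRing _ _
  fieldRing = record { isCommutativeRing = isCommutativeRing }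

  module R = CommutativeRing fieldRing
  module RP = RingProperties R.ring
  open import Algebra.Properties.CommutativeSemigroup R.*-commutativeSemigroup public
    using () renaming (x∙yz≈y∙xz to *F-left-swap)

  infixl 6 _-F_
  _-F_ : F → F → F
  x -F y = x +F (-F y)

  add-sub : ∀ x a → (x +F a) -F a ≡ x
  add-sub x a =
    trans (R.+-assoc x a (-F a)) (trans (cong (x +F_) (R.-‿inverseʳ a)) (R.+-identityʳ x))

  sub-add : ∀ x a → (x -F a) +F a ≡ x
  sub-add x a =
    trans (R.+-assoc x (-F a) a) (trans (cong (x +F_) (R.-‿inverseˡ a)) (R.+-identityʳ x))

  inv : (c : F) → ¬ c ≡ 0# → F
  inv c c≢0 = proj₁ (inverse c c≢0)

  inv-cancelˡ : ∀ c c≢0 x → inv c c≢0 *F (c *F x) ≡ x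
  inv-cancelˡ c c≢0 x = begin
    inv c c≢0 *F (c *F x) ≡⟨ sym (R.*-assoc _ c x) ⟩
    (inv c c≢0 *F c) *F x ≡⟨ cong (_*F x) (trans (R.*-comm _ c) (proj₂ (inverse c c≢0))) ⟩
    1# *F x               ≡⟨ R.*-identityˡ x ⟩
    x                     ∎
    where open ≡-Reasoning

  inv-cancelʳ : ∀ c c≢0 x → c *F (inv c c≢0 *F x) ≡ x
  inv-cancelʳ c c≢0 x = begin
    c *F (inv c c≢0 *F x) ≡⟨ sym (R.*-assoc c _ x) ⟩
    (c *F inv c c≢0) *F x ≡⟨ cong (_*F x) (proj₂ (inverse c c≢0)) ⟩
    1# *F x               ≡⟨ R.*-identityˡ x ⟩
    x                     ∎
    where open ≡-Reasoning

  *-cancelˡ : ∀ c → ¬ c ≡ 0# → ∀ {a b} → c *F a ≡ c *F b → a ≡ b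
  *-cancelˡ c c≢0 {a} {b} e =
    trans (sym (inv-cancelˡ c c≢0 a)) (trans (cong (inv c c≢0 *F_) e) (inv-cancelˡ c c≢0 b))

  *-nonzero : ∀ {a b} → ¬ a ≡ 0# → ¬ b ≡ 0# → ¬ (a *F b) ≡ 0#
  *-nonzero {a} a≢0 b≢0 ab≡0 = b≢0 (*-cancelˡ a a≢0 (trans ab≡0 (sym (R.zeroʳ a))))

  ind-∧ : ∀ a b → ind (a ∧ b) ≡ ind a * ind b
  ind-∧ true  b = sym (+-identityʳ _)
  ind-∧ false b = refl

  ind-idem : ∀ a → ind a * ind a ≡ ind a
  ind-idem true  = refl
  ind-idem false = refl

  ∧-trueˡ : ∀ {a b} → a ∧ b ≡ true → a ≡ true
  ∧-trueˡ {true} _ = refl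

  ∧-trueʳ : ∀ {a b} → a ∧ b ≡ true → b ≡ true
  ∧-trueʳ {true} e = e

  bool-ext : ∀ {a b : Bool} → (a ≡ true → b ≡ true) → (b ≡ true → a ≡ true) → a ≡ b
  bool-ext {true}  {true}  _ _ = refl
  bool-ext {false} {false} _ _ = refl
  bool-ext {true}  {false} p _ = sym (p refl)
  bool-ext {false} {true}  _ q = q refl

  ≟-sound : ∀ {a b} → ⌊ a ≟ b ⌋ ≡ true → a ≡ b
  ≟-sound {a} {b} e with a ≟ b
  ... | yes a≡b = a≡b

  ≟-refl : ∀ a → ⌊ a ≟ a ⌋ ≡ true
  ≟-refl a with a ≟ a
  ... | yes _   = refl
  ... | no  a≢a = ⊥-elim (a≢a refl)

  any-witness : ∀ (p : F → Bool) xs → any p xs ≡ true → ∃ λ x → p x ≡ true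
  any-witness p (x ∷ xs) e with p x in px
  ... | true  = x , px
  ... | false = any-witness p xs e

  any-intro : ∀ (p : F → Bool) {xs x} → x ∈ xs → p x ≡ true → any p xs ≡ true
  any-intro p (here refl) px rewrite px = refl
  any-intro p {y ∷ _} (there m) px with p y
  ... | true  = refl
  ... | false = any-intro p m px

  any-cong : ∀ (p q : F → Bool) xs → (∀ x → p x ≡ q x) → any p xs ≡ any q xs
  any-cong p q []       e = refl
  any-cong p q (x ∷ xs) e = cong₂ _∨_ (e x) (any-cong p q xs e)

  any-false⇒∑≡0 : ∀ (p : F → Bool) xs → any p xs ≡ false → ∑ xs (λ x → ind (p x)) ≡ 0
  any-false⇒∑≡0 p []       e = refl
  any-false⇒∑≡0 p (x ∷ xs) e with p x
  ... | false = any-false⇒∑≡0 p xs e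

  scale-elim : ∀ c X x → scale c X x ≡ true → ∃ λ g → X g ≡ true × x ≡ c *F g
  scale-elim c X x e with any-witness _ elements e
  ... | g , h = g , ∧-trueˡ h , ≟-sound (∧-trueʳ {X g} h)

  scale-intro : ∀ c X g → X g ≡ true → scale c X (c *F g) ≡ true
  scale-intro c X g Xg = any-intro _ (complete g)
    (subst (λ t → t ∧ ⌊ c *F g ≟ c *F g ⌋ ≡ true) (sym Xg) (≟-refl (c *F g)))

  -- Sums over F: the Kronecker delta picks out one term, since `elements`
  -- lists every field element exactly once.
  δ : F → F → ℕ
  δ a b = ind ⌊ a ≟ b ⌋

  δ-iff : ∀ {a b c d} → (a ≡ b → c ≡ d) → (c ≡ d → a ≡ b) → δ a b ≡ δ c d
  δ-iff {a} {b} {c} {d} p q with a ≟ b | c ≟ d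
  ... | yes _   | yes _   = refl
  ... | no  _   | no  _   = refl
  ... | yes a≡b | no  c≢d = ⊥-elim (c≢d (p a≡b))
  ... | no  a≢b | yes c≡d = ⊥-elim (a≢b (q c≡d))

  private
    ∑δ-list : ∀ xs → Unique xs → ∀ {a} → a ∈ xs → (f : F → ℕ) →
              ∑ xs (λ x → δ x a * f x) ≡ f a
    ∑δ-list (x ∷ xs) (x∉xs ∷ _) (here refl) f with x ≟ x
    ... | yes _   = trans (cong₂ _+_ (+-identityʳ (f x)) (∑-zero-on x∉xs)) (+-identityʳ (f x))
      where
        ∑-zero-on : ∀ {ys} → ListAll.All (λ y → ¬ x ≡ y) ys → ∑ ys (λ y → δ y x * f y) ≡ 0
        ∑-zero-on ListAll.[] = refl
        ∑-zero-on {y ∷ _} (x≢y ListAll.∷ rest) with y ≟ x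
        ... | yes y≡x = ⊥-elim (x≢y (sym y≡x))
        ... | no  _   = ∑-zero-on rest
    ... | no  x≢x = ⊥-elim (x≢x refl)
    ∑δ-list (x ∷ xs) (x∉xs ∷ u) {a} (there a∈xs) f with x ≟ a
    ... | yes x≡a = ⊥-elim (ListAll.lookup x∉xs a∈xs x≡a)
    ... | no  _   = ∑δ-list xs u a∈xs f

  ΣF-δ : ∀ a (f : F → ℕ) → ΣF (λ x → δ x a * f x) ≡ f a
  ΣF-δ a = ∑δ-list elements unique (complete a)

  ΣF-reindex : (σ τ : F → F) → (∀ x → σ (τ x) ≡ x) → (∀ y → τ (σ y) ≡ y) →
               ∀ f → ΣF (λ y → f (σ y)) ≡ ΣF f
  ΣF-reindex σ τ στ τσ f = begin
    ΣF (λ y → f (σ y))                     ≡⟨ ∑-cong elements (λ y → sym (ΣF-δ (σ y) f)) ⟩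
    ΣF (λ y → ΣF (λ x → δ x (σ y) * f x))  ≡⟨ ∑-swap elements elements _ ⟩
    ΣF (λ x → ΣF (λ y → δ x (σ y) * f x))  ≡⟨ ∑-cong elements (λ x → ∑-cong elements (λ y →
                                                cong (_* f x) (δ-iff (inverted y x) (inverted' y x)))) ⟩
    ΣF (λ x → ΣF (λ y → δ y (τ x) * f x))  ≡⟨ ∑-cong elements (λ x → ΣF-δ (τ x) (λ _ → f x)) ⟩
    ΣF f                                   ∎
    where
      open ≡-Reasoning
      inverted : ∀ y x → x ≡ σ y → y ≡ τ x
      inverted y x x≡σy = trans (sym (τσ y)) (cong τ (sym x≡σy))
      inverted' : ∀ y x → y ≡ τ x → x ≡ σ y
      inverted' y x y≡τx = trans (sym (στ x)) (cong σ (sym y≡τx))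

  ΣF-dilate : ∀ c → ¬ c ≡ 0# → ∀ f → ΣF (λ y → f (c *F y)) ≡ ΣF f
  ΣF-dilate c c≢0 = ΣF-reindex (c *F_) (inv c c≢0 *F_) (inv-cancelʳ c c≢0) (inv-cancelˡ c c≢0)

  ΣF-translate : ∀ a f → ΣF (λ y → f (y +F a)) ≡ ΣF f
  ΣF-translate a = ΣF-reindex (_+F a) (_-F a) (λ x → sub-add x a) (λ y → add-sub y a)

  card-pos : ∀ (X : Subset) → Nonempty X → 1 ≤ ∣ X ∣
  card-pos X (x , Xx) =
    subst (_≤ ∣ X ∣) (cong ind Xx) (∑-≤-member elements (λ y → ind (X y)) (complete x))

  ΣF-if : ∀ (X : Subset) c → ΣF (λ y → if X y then c else 0) ≡ ∣ X ∣ * c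
  ΣF-if X c = trans (∑-cong elements as-product) (∑-*ʳ elements c (λ y → ind (X y)))
    where
      as-product : ∀ y → (if X y then c else 0) ≡ ind (X y) * c
      as-product y with X y
      ... | true  = sym (+-identityʳ c)
      ... | false = refl

  conv-neg : ∀ Q d → conv Q (-F d) ≡ conv Q d
  conv-neg Q d = begin
    ΣF (λ y → ind (Q y ∧ Q (y -F d)))               ≡⟨ sym (ΣF-translate d _) ⟩
    ΣF (λ u → ind (Q (u +F d) ∧ Q ((u +F d) -F d))) ≡⟨ ∑-cong elements (λ u →
                                                        trans (cong (λ t → ind (Q (u +F d) ∧ Q t)) (add-sub u d))
                                                              (cong ind (∧-comm (Q (u +F d)) (Q u)))) ⟩
    ΣF (λ u → ind (Q u ∧ Q (u +F d)))               ∎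
    where open ≡-Reasoning

  conv-dilate : ∀ Q γ → ¬ γ ≡ 0# → (∀ x → Q (γ *F x) ≡ Q x) → ∀ d → conv Q (γ *F d) ≡ conv Q d
  conv-dilate Q γ γ≢0 Q-inv d = begin
    ΣF (λ y → ind (Q y ∧ Q (y +F γ *F d)))               ≡⟨ sym (ΣF-dilate γ γ≢0 _) ⟩
    ΣF (λ u → ind (Q (γ *F u) ∧ Q (γ *F u +F γ *F d)))   ≡⟨ ∑-cong elements (λ u →
                                                             cong₂ (λ a b → ind (a ∧ b)) (Q-inv u)
                                                               (trans (cong Q (sym (R.distribˡ γ u d))) (Q-inv (u +F d)))) ⟩
    ΣF (λ u → ind (Q u ∧ Q (u +F d)))                    ∎
    where open ≡-Reasoning

  ΣV : ∀ k → (Vec F k → ℕ) → ℕ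
  ΣV k = ∑ (allVecs k)

  ΣV-suc : ∀ k f → ΣV (suc k) f ≡ ΣF (λ x → ΣV k (λ v → f (x ∷ v)))
  ΣV-suc k f = trans (∑-concatMap elements (λ x → map (x ∷_) (allVecs k)) f)
                     (∑-cong elements (λ x → ∑-map (allVecs k) (x ∷_) f))

  shift : ∀ {k} → F → Vec F k → Vec F k
  shift {k} d v = zipWith _+F_ v (Δ k d)

  shift-shift : ∀ {k} a c (u : Vec F k) → shift a (shift c u) ≡ shift (c +F a) u
  shift-shift a c []      = refl
  shift-shift a c (x ∷ u) = cong₂ _∷_ (R.+-assoc x c a) (shift-shift a c u)

  shift-zero : ∀ {k} (u : Vec F k) → shift 0# u ≡ u
  shift-zero []      = refl
  shift-zero (x ∷ u) = cong₂ _∷_ (R.+-identityʳ x) (shift-zero u)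

  ΣV-shift : ∀ k a (f : Vec F k → ℕ) → ΣV k (λ v → f (shift a v)) ≡ ΣV k f
  ΣV-shift 0       a f = refl
  ΣV-shift (suc k) a f = begin
    ΣV (suc k) (λ v → f (shift a v))             ≡⟨ ΣV-suc k _ ⟩
    ΣF (λ x → ΣV k (λ v → f ((x +F a) ∷ shift a v)))
      ≡⟨ ∑-cong elements (λ x → ΣV-shift k a (λ v → f ((x +F a) ∷ v))) ⟩
    ΣF (λ x → ΣV k (λ v → f ((x +F a) ∷ v)))     ≡⟨ ΣF-translate a (λ x → ΣV k (λ v → f (x ∷ v))) ⟩
    ΣF (λ x → ΣV k (λ v → f (x ∷ v)))            ≡⟨ sym (ΣV-suc k f) ⟩
    ΣV (suc k) f                                 ∎
    where open ≡-Reasoning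

  inPow : ∀ {k} → Subset → Vec F k → ℕ
  inPow Q v = ind (allB Q v)

  ΣV-power : ∀ k Q → ΣV k (inPow Q) ≡ ∣ Q ∣ ^ k
  ΣV-power 0       Q = refl
  ΣV-power (suc k) Q = begin
    ΣV (suc k) (inPow Q)                       ≡⟨ ΣV-suc k _ ⟩
    ΣF (λ x → ΣV k (λ v → ind (Q x ∧ allB Q v)))
      ≡⟨ ∑-cong elements (λ x → trans (∑-cong (allVecs k) (λ v → ind-∧ (Q x) _))
                                      (∑-*ˡ (allVecs k) (ind (Q x)) (inPow Q))) ⟩
    ΣF (λ x → ind (Q x) * ΣV k (inPow Q))      ≡⟨ ∑-*ʳ elements _ _ ⟩
    ∣ Q ∣ * ΣV k (inPow Q)                     ≡⟨ cong (∣ Q ∣ *_) (ΣV-power k Q) ⟩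
    ∣ Q ∣ ^ suc k                              ∎
    where open ≡-Reasoning

  -- |Q^k ∩ (Q^k - Δ(d))| = C(d)^k: the coordinates contribute independently.
  ΣV-correlation : ∀ k Q d → ΣV k (λ v → inPow Q v * inPow Q (shift d v)) ≡ conv Q d ^ k
  ΣV-correlation 0       Q d = refl
  ΣV-correlation (suc k) Q d = begin
    ΣV (suc k) (λ v → inPow Q v * inPow Q (shift d v))  ≡⟨ ΣV-suc k _ ⟩
    ΣF (λ x → ΣV k (λ v → ind (Q x ∧ allB Q v) * ind (Q (x +F d) ∧ allB Q (shift d v))))
      ≡⟨ ∑-cong elements (λ x → ∑-cong (allVecs k) (λ v →
           trans (cong₂ _*_ (ind-∧ (Q x) _) (ind-∧ (Q (x +F d)) _))
                 ([m*n]*[o*p]≡[m*o]*[n*p] (ind (Q x)) _ _ _))) ⟩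
    ΣF (λ x → ΣV k (λ v → (ind (Q x) * ind (Q (x +F d))) * (inPow Q v * inPow Q (shift d v))))
      ≡⟨ ∑-cong elements (λ x → ∑-*ˡ (allVecs k) (ind (Q x) * ind (Q (x +F d))) _) ⟩
    ΣF (λ x → (ind (Q x) * ind (Q (x +F d))) * ΣV k (λ v → inPow Q v * inPow Q (shift d v)))
      ≡⟨ ∑-cong elements (λ x → cong₂ _*_ (sym (ind-∧ (Q x) _)) (ΣV-correlation k Q d)) ⟩
    ΣF (λ x → ind (Q x ∧ Q (x +F d)) * conv Q d ^ k)  ≡⟨ ∑-*ʳ elements _ _ ⟩
    conv Q d ^ suc k                                 ∎
    where open ≡-Reasoning

  ΣV-correlation₂ : ∀ k Q a b →
    ΣV k (λ v → inPow Q (shift a v) * inPow Q (shift b v)) ≡ conv Q (-F a +F b) ^ k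
  ΣV-correlation₂ k Q a b = begin
    ΣV k (λ v → inPow Q (shift a v) * inPow Q (shift b v))  ≡⟨ sym (ΣV-shift k (-F a) _) ⟩
    ΣV k (λ u → inPow Q (shift a (shift (-F a) u)) * inPow Q (shift b (shift (-F a) u)))
      ≡⟨ ∑-cong (allVecs k) (λ u → cong₂ (λ x y → inPow Q x * inPow Q y)
           (trans (shift-shift a (-F a) u) (trans (cong (λ t → shift t u) (R.-‿inverseˡ a)) (shift-zero u)))
           (shift-shift b (-F a) u)) ⟩
    ΣV k (λ u → inPow Q u * inPow Q (shift (-F a +F b) u))  ≡⟨ ΣV-correlation k Q (-F a +F b) ⟩
    conv Q (-F a +F b) ^ k                                  ∎
    where open ≡-Reasoning

  allB-sound : ∀ Q {k} (v : Vec F k) → allB Q v ≡ true → All (λ c → Q c ≡ true) v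
  allB-sound Q []      _ = []
  allB-sound Q (x ∷ v) e = ∧-trueˡ e ∷ allB-sound Q v (∧-trueʳ {Q x} e)

  allB-complete : ∀ Q {k} (v : Vec F k) → All (λ c → Q c ≡ true) v → allB Q v ≡ true
  allB-complete Q []      []         = refl
  allB-complete Q (x ∷ v) (Qx ∷ Qv) rewrite Qx = allB-complete Q v Qv

  ∣∣ᵛ-cong : ∀ {k} {V W : VSubset k} → (∀ v → V v ≡ W v) → ∣ V ∣ᵛ ≡ ∣ W ∣ᵛ
  ∣∣ᵛ-cong {k} e = ∑-cong (allVecs k) (λ v → cong ind (e v))

  powPlusΔ-as-union : ∀ k Q Z v → unionShift Sign.+ Z (λ _ → allB {k} Q) v ≡ powPlusΔ k Q Z v
  powPlusΔ-as-union k Q Z v =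
    any-cong _ _ elements (λ z → cong (Z z ∧_) (shifted-membership z v))
    where
      shifted-membership : ∀ z {n} (u : Vec F n) → allB Q (unshift Sign.+ u z) ≡ allB (λ c → Q (c -F z)) u
      shifted-membership z []      = refl
      shifted-membership z (x ∷ u) = cong (Q (x -F z) ∧_) (shifted-membership z u)

  sumset-as-union : ∀ Q Z → ∣ unionShift Sign.+ Z (λ _ → allB {1} Q) ∣ᵛ ≡ ∣ Q ⊕ Z ∣
  sumset-as-union Q Z =
    trans (ΣV-suc 0 _) (∑-cong elements (λ x → trans (+-identityʳ _)
      (cong ind (any-cong _ _ elements (λ y → cong (Z y ∧_) (∧-identityʳ _))))))

module Coset (𝔽 : FiniteField) (Γ : FF.Subset 𝔽) (Γ-subgroup : FF.IsMulSubgroup 𝔽 Γ)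
             (ξ : FF.F 𝔽) (ξ≢0 : ¬ ξ ≡ FF.0# 𝔽) where

  open FiniteSums
  open FieldSums 𝔽
  open IsMulSubgroup Γ-subgroup

  Γ* : Subset
  Γ* = scale ξ Γ

  Γ-nonzero : ∀ {γ} → Γ γ ≡ true → ¬ γ ≡ 0#
  Γ-nonzero Γγ refl with trans (sym Γγ) zero∉
  ... | ()

  Γ-inv : ∀ {γ} (Γγ : Γ γ ≡ true) → Γ (inv γ (Γ-nonzero Γγ)) ≡ true
  Γ-inv {γ} Γγ = inv∈ γ _ Γγ (proj₂ (inverse γ (Γ-nonzero Γγ)))

  Γ*-nonzero : ∀ {w} → Γ* w ≡ true → ¬ w ≡ 0#
  Γ*-nonzero {w} Γ*w with scale-elim ξ Γ w Γ*w
  ... | g , Γg , refl = *-nonzero ξ≢0 (Γ-nonzero Γg)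

  Γ*-ratio : ∀ {y} → Γ* y ≡ true → ∀ γ → Γ* (γ *F y) ≡ Γ γ
  Γ*-ratio {y} Γ*y γ with scale-elim ξ Γ y Γ*y
  ... | g , Γg , refl = bool-ext to from
    where
      to : Γ* (γ *F (ξ *F g)) ≡ true → Γ γ ≡ true
      to Γ*γy with scale-elim ξ Γ _ Γ*γy
      ... | g' , Γg' , γξg≡ξg' = subst (λ t → Γ t ≡ true) ratio (mul∈ g' _ Γg' (Γ-inv Γg))
        where
          γg≡g' : γ *F g ≡ g'
          γg≡g' = *-cancelˡ ξ ξ≢0 (trans (sym (*F-left-swap γ ξ g)) γξg≡ξg')
          ratio : g' *F inv g (Γ-nonzero Γg) ≡ γ
          ratio = trans (cong (_*F _) (sym γg≡g'))
                        (trans (R.*-assoc γ g _) (trans (cong (γ *F_) (proj₂ (inverse g _))) (R.*-identityʳ γ)))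
      from : Γ γ ≡ true → Γ* (γ *F (ξ *F g)) ≡ true
      from Γγ = subst (λ t → Γ* t ≡ true) (*F-left-swap ξ γ g)
                  (scale-intro ξ Γ (γ *F g) (mul∈ γ g Γγ Γg))

  Γ*-invariant : ∀ {γ} → Γ γ ≡ true → ∀ u → Γ* (γ *F u) ≡ Γ* u
  Γ*-invariant {γ} Γγ u = bool-ext to from
    where
      to : Γ* (γ *F u) ≡ true → Γ* u ≡ true
      to Γ*γu = trans (cong Γ* (sym (inv-cancelˡ γ (Γ-nonzero Γγ) u)))
                      (trans (Γ*-ratio Γ*γu _) (Γ-inv Γγ))
      from : Γ* u ≡ true → Γ* (γ *F u) ≡ true
      from Γ*u = trans (Γ*-ratio Γ*u γ) Γγ

  coset-average : ∀ (f : F → ℕ) → (∀ {γ} → Γ γ ≡ true → ∀ y → f (γ *F y) ≡ f y) →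
                  ∀ {y} → Γ* y ≡ true → ∣ Γ ∣ * f y ≡ ΣF (λ w → ind (Γ* w) * f w)
  coset-average f f-inv {y} Γ*y = sym (begin
    ΣF (λ w → ind (Γ* w) * f w)                  ≡⟨ sym (ΣF-dilate y (Γ*-nonzero Γ*y) _) ⟩
    ΣF (λ γ → ind (Γ* (y *F γ)) * f (y *F γ))    ≡⟨ ∑-cong elements orbit-term ⟩
    ΣF (λ γ → ind (Γ γ) * f y)                   ≡⟨ ∑-*ʳ elements (f y) (λ γ → ind (Γ γ)) ⟩
    ∣ Γ ∣ * f y                                  ∎)
    where
      open ≡-Reasoning
      orbit-term : ∀ γ → ind (Γ* (y *F γ)) * f (y *F γ) ≡ ind (Γ γ) * f y
      orbit-term γ rewrite R.*-comm y γ | Γ*-ratio Γ*y γ with Γ γ in Γγ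
      ... | true  = cong (_+ 0) (f-inv Γγ y)
      ... | false = refl

module Energy (𝔽 : FiniteField) (Γ : FF.Subset 𝔽) (Γ-subgroup : FF.IsMulSubgroup 𝔽 Γ)
              (ξ : FF.F 𝔽) (ξ≢0 : ¬ ξ ≡ FF.0# 𝔽)
              (Q : FF.Subset 𝔽) (Q-invariant : FF.GammaInvariant 𝔽 Γ Q) (k : ℕ) where

  open FiniteSums
  open FieldSums 𝔽
  open Coset 𝔽 Γ Γ-subgroup ξ ξ≢0

  C : F → ℕ
  C = conv Q

  Q-dilate : ∀ {γ} → Γ γ ≡ true → ∀ x → Q (γ *F x) ≡ Q x
  Q-dilate {γ} Γγ x = bool-ext to from
    where
      to : Q (γ *F x) ≡ true → Q x ≡ true
      to Qγx with scale-elim γ Q (γ *F x) (trans (Q-invariant γ Γγ (γ *F x)) Qγx)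
      ... | g , Qg , γx≡γg = subst (λ t → Q t ≡ true) (sym (*-cancelˡ γ (Γ-nonzero Γγ) γx≡γg)) Qg
      from : Q x ≡ true → Q (γ *F x) ≡ true
      from Qx = trans (sym (Q-invariant γ Γγ (γ *F x))) (scale-intro γ Q x Qx)

  rowEnergy : F → ℕ
  rowEnergy y = ΣF (λ y' → ind (Γ* y') * C (y' -F y) ^ k)

  rowEnergy-invariant : ∀ {γ} → Γ γ ≡ true → ∀ y → rowEnergy (γ *F y) ≡ rowEnergy y
  rowEnergy-invariant {γ} Γγ y = begin
    ΣF (λ y' → ind (Γ* y') * C (y' -F γ *F y) ^ k)           ≡⟨ sym (ΣF-dilate γ (Γ-nonzero Γγ) _) ⟩
    ΣF (λ u → ind (Γ* (γ *F u)) * C (γ *F u -F γ *F y) ^ k)  ≡⟨ ∑-cong elements (λ u →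
                                                                  cong₂ (λ a b → ind a * b ^ k) (Γ*-invariant Γγ u)
                                                                    (trans (cong C (factor u)) (conv-dilate Q γ (Γ-nonzero Γγ) (Q-dilate Γγ) (u -F y)))) ⟩
    rowEnergy y                                              ∎
    where
      open ≡-Reasoning
      factor : ∀ u → γ *F u -F γ *F y ≡ γ *F (u -F y)
      factor u = trans (cong (γ *F u +F_) (RP.-‿distribʳ-* γ y)) (sym (R.distribˡ γ u (-F y)))

  -- Summing the rows over Γ* recovers E_{k+1}(Γ*, Q), via y' = x + w.
  rowEnergy-total : ΣF (λ w → ind (Γ* w) * rowEnergy w) ≡ E (k + 1) Γ* Q
  rowEnergy-total = begin
    ΣF (λ w → ind (Γ* w) * ΣF (λ y' → ind (Γ* y') * C (y' -F w) ^ k))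
      ≡⟨ ∑-cong elements (λ w → sym (∑-*ˡ elements (ind (Γ* w)) _)) ⟩
    ΣF (λ w → ΣF (λ y' → ind (Γ* w) * (ind (Γ* y') * C (y' -F w) ^ k)))
      ≡⟨ ∑-cong elements (λ w → sym (ΣF-translate w _)) ⟩
    ΣF (λ w → ΣF (λ x → ind (Γ* w) * (ind (Γ* (x +F w)) * C ((x +F w) -F w) ^ k)))
      ≡⟨ ∑-cong elements (λ w → ∑-cong elements (λ x →
           cong₂ (λ a b → ind (Γ* w) * (ind (Γ* a) * C b ^ k)) (R.+-comm x w) (add-sub x w))) ⟩
    ΣF (λ w → ΣF (λ x → ind (Γ* w) * (ind (Γ* (w +F x)) * C x ^ k)))
      ≡⟨ ∑-swap elements elements _ ⟩
    ΣF (λ x → ΣF (λ w → ind (Γ* w) * (ind (Γ* (w +F x)) * C x ^ k)))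
      ≡⟨ ∑-cong elements (λ x → ∑-cong elements (λ w →
           trans (sym (*-assoc (ind (Γ* w)) _ _)) (cong (_* C x ^ k) (sym (ind-∧ (Γ* w) _))))) ⟩
    ΣF (λ x → ΣF (λ w → ind (Γ* w ∧ Γ* (w +F x)) * C x ^ k))
      ≡⟨ ∑-cong elements (λ x → trans (∑-*ʳ elements (C x ^ k) _)
                                      (cong (λ t → conv Γ* x * C x ^ t) (sym (m+n∸n≡m k 1)))) ⟩
    E (k + 1) Γ* Q ∎
    where open ≡-Reasoning

  rowEnergy-constant : ∀ {y} → Γ* y ≡ true → ∣ Γ ∣ * rowEnergy y ≡ E (k + 1) Γ* Q
  rowEnergy-constant Γ*y = trans (coset-average rowEnergy rowEnergy-invariant Γ*y) rowEnergy-total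

  pairEnergy : Subset → ℕ
  pairEnergy Γ' = ΣF (λ y → ΣF (λ y' → (ind (Γ' y) * ind (Γ' y')) * C (y' -F y) ^ k))

  pairEnergy-bound : ∀ Γ' → Γ' ⊆ Γ* → ∣ Γ ∣ * pairEnergy Γ' ≤ ∣ Γ' ∣ * E (k + 1) Γ* Q
  pairEnergy-bound Γ' Γ'⊆Γ* = begin
    ∣ Γ ∣ * pairEnergy Γ'
      ≤⟨ *-monoʳ-≤ ∣ Γ ∣ (∑-mono elements (λ y → ≤-trans
           (≤-reflexive (trans (∑-cong elements (λ y' → *-assoc (ind (Γ' y)) _ _)) (∑-*ˡ elements (ind (Γ' y)) _)))
           (*-monoʳ-≤ (ind (Γ' y)) (∑-mono elements (λ y' → *-monoˡ-≤ (C (y' -F y) ^ k) (ind-⊆ y')))))) ⟩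
    ∣ Γ ∣ * ΣF (λ y → ind (Γ' y) * rowEnergy y)   ≡⟨ sym (∑-*ˡ elements ∣ Γ ∣ _) ⟩
    ΣF (λ y → ∣ Γ ∣ * (ind (Γ' y) * rowEnergy y)) ≡⟨ ∑-cong elements row ⟩
    ΣF (λ y → ind (Γ' y) * E (k + 1) Γ* Q)        ≡⟨ ∑-*ʳ elements _ _ ⟩
    ∣ Γ' ∣ * E (k + 1) Γ* Q                       ∎
    where
      open ≤-Reasoning
      ind-⊆ : ∀ y → ind (Γ' y) ≤ ind (Γ* y)
      ind-⊆ y with Γ' y in Γ'y
      ... | true rewrite Γ'⊆Γ* y Γ'y = ≤-refl
      ... | false = z≤n
      row : ∀ y → ∣ Γ ∣ * (ind (Γ' y) * rowEnergy y) ≡ ind (Γ' y) * E (k + 1) Γ* Q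
      row y with Γ' y in Γ'y
      ... | true  = trans (cong (∣ Γ ∣ *_) (+-identityʳ _))
                          (trans (rowEnergy-constant (Γ'⊆Γ* y Γ'y)) (sym (+-identityʳ _)))
      ... | false = *-zeroʳ ∣ Γ ∣

module TranslateUnion (𝔽 : FiniteField) (Γ : FF.Subset 𝔽) (Γ-subgroup : FF.IsMulSubgroup 𝔽 Γ)
                      (ξ : FF.F 𝔽) (ξ≢0 : ¬ ξ ≡ FF.0# 𝔽)
                      (Q : FF.Subset 𝔽) (Q-invariant : FF.GammaInvariant 𝔽 Γ Q) (k : ℕ) where

  open FiniteSums
  open FieldSums 𝔽
  open Coset 𝔽 Γ Γ-subgroup ξ ξ≢0
  open Energy 𝔽 Γ Γ-subgroup ξ ξ≢0 Q Q-invariant k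

  -- `unshift s v y`, i.e. v ∓ Δ(y), is the translate of v by Δ(σ s y).
  σ : Sign → F → F
  σ Sign.+ y = -F y
  σ Sign.- y = y

  unshift-shift : ∀ s {n} (v : Vec F n) y → unshift s v y ≡ shift (σ s y) v
  unshift-shift Sign.+ []      y = refl
  unshift-shift Sign.+ (x ∷ v) y = cong (x -F y ∷_) (unshift-shift Sign.+ v y)
  unshift-shift Sign.- v       y = refl

  -- Whatever the sign, two translates by y and y' overlap in C(y' - y)^k points.
  σ-difference : ∀ s y y' → C (-F σ s y +F σ s y') ≡ C (y' -F y)
  σ-difference Sign.- y y' = cong C (R.+-comm (-F y) y')
  σ-difference Sign.+ y y' =
    trans (cong C (trans (R.+-comm (-F (-F y)) (-F y')) (RP.-‿+-comm y' (-F y))))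
          (conv-neg Q (y' -F y))

  module _ (Γ' : Subset) (Γ'⊆Γ* : Γ' ⊆ Γ*) (Qf : F → VSubset k)
           (Qf⊆Q^k : ∀ y → Γ' y ≡ true → Qf y ⊆Pow Q) (s : Sign) where

    U : VSubset k
    U = unionShift s Γ' Qf

    incidence : F → Vec F k → ℕ
    incidence y v = ind (Γ' y ∧ Qf y (unshift s v y))

    multiplicity : Vec F k → ℕ
    multiplicity v = ΣF (λ y → incidence y v)

    mass : ℕ
    mass = ΣF (λ y → if Γ' y then ∣ Qf y ∣ᵛ else 0)

    -- (1): each translate Q^(y) ± Δ(y) has |Q^(y)| points.
    multiplicity-total : ΣV k multiplicity ≡ mass
    multiplicity-total =
      trans (∑-swap (allVecs k) elements (λ v y → incidence y v)) (∑-cong elements translate-size)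
      where
        translate-size : ∀ y → ΣV k (incidence y) ≡ (if Γ' y then ∣ Qf y ∣ᵛ else 0)
        translate-size y with Γ' y
        ... | true  = trans (∑-cong (allVecs k) (λ v → cong (λ w → ind (Qf y w)) (unshift-shift s v y)))
                            (ΣV-shift k (σ s y) (λ w → ind (Qf y w)))
        ... | false = ∑-zero (allVecs k)

    multiplicity-supported : ∀ v → ind (U v) * multiplicity v ≡ multiplicity v
    multiplicity-supported v with U v in Uv
    ... | true  = +-identityʳ _
    ... | false = sym (any-false⇒∑≡0 (λ y → Γ' y ∧ Qf y (unshift s v y)) elements Uv)

    multiplicity-cauchy-schwarz :
      ΣV k multiplicity * ΣV k multiplicity ≤ ∣ U ∣ᵛ * ΣV k (λ v → multiplicity v * multiplicity v)
    multiplicity-cauchy-schwarz =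
      cauchy-schwarz-support (allVecs k) (λ v → ind (U v)) multiplicity
        (λ v → ind-idem (U v)) multiplicity-supported

    incidence-bound : ∀ y v → incidence y v ≤ ind (Γ' y) * inPow Q (shift (σ s y) v)
    incidence-bound y v with Γ' y in Γ'y
    ... | false = z≤n
    ... | true rewrite sym (unshift-shift s v y) with Qf y (unshift s v y) in inQf
    ...   | false = z≤n
    ...   | true rewrite allB-complete Q (unshift s v y) (Qf⊆Q^k y Γ'y (unshift s v y) inQf) = ≤-refl

    -- (3): Σ_v r(v)² counts pairs of overlapping translates.
    multiplicity-second-moment : ΣV k (λ v → multiplicity v * multiplicity v) ≤ pairEnergy Γ'
    multiplicity-second-moment = begin
      ΣV k (λ v → multiplicity v * multiplicity v)
        ≡⟨ ∑-cong (allVecs k) (λ v → ∑-product elements elements (λ y → incidence y v) (λ y → incidence y v)) ⟩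
      ΣV k (λ v → ΣF (λ y → ΣF (λ y' → incidence y v * incidence y' v)))
        ≡⟨ trans (∑-swap (allVecs k) elements _) (∑-cong elements (λ y → ∑-swap (allVecs k) elements _)) ⟩
      ΣF (λ y → ΣF (λ y' → ΣV k (λ v → incidence y v * incidence y' v)))
        ≤⟨ ∑-mono elements (λ y → ∑-mono elements (λ y' → ∑-mono (allVecs k) (λ v → ≤-trans
             (*-mono-≤ (incidence-bound y v) (incidence-bound y' v))
             (≤-reflexive ([m*n]*[o*p]≡[m*o]*[n*p] (ind (Γ' y)) _ _ _))))) ⟩
      ΣF (λ y → ΣF (λ y' → ΣV k (λ v → (ind (Γ' y) * ind (Γ' y'))
                                         * (inPow Q (shift (σ s y) v) * inPow Q (shift (σ s y') v)))))
        ≡⟨ ∑-cong elements (λ y → ∑-cong elements (λ y' → overlap-count y y')) ⟩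
      pairEnergy Γ' ∎
      where
        open ≤-Reasoning
        overlap-count : ∀ y y' →
          ΣV k (λ v → (ind (Γ' y) * ind (Γ' y')) * (inPow Q (shift (σ s y) v) * inPow Q (shift (σ s y') v)))
            ≡ (ind (Γ' y) * ind (Γ' y')) * C (y' -F y) ^ k
        overlap-count y y' = trans (∑-*ˡ (allVecs k) (ind (Γ' y) * ind (Γ' y')) _)
          (cong ((ind (Γ' y) * ind (Γ' y')) *_)
            (trans (ΣV-correlation₂ k Q (σ s y) (σ s y')) (cong (_^ k) (σ-difference s y y'))))

    union-bound : ∣ Γ ∣ * mass ^ 2 ≤ ∣ U ∣ᵛ * (∣ Γ' ∣ * E (k + 1) Γ* Q)
    union-bound = begin
      ∣ Γ ∣ * mass ^ 2
        ≡⟨ cong (λ t → ∣ Γ ∣ * t ^ 2) (sym multiplicity-total) ⟩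
      ∣ Γ ∣ * (ΣV k multiplicity * (ΣV k multiplicity * 1))
        ≡⟨ cong (λ t → ∣ Γ ∣ * (ΣV k multiplicity * t)) (*-identityʳ _) ⟩
      ∣ Γ ∣ * (ΣV k multiplicity * ΣV k multiplicity)
        ≤⟨ *-monoʳ-≤ ∣ Γ ∣ (≤-trans multiplicity-cauchy-schwarz
                              (*-monoʳ-≤ ∣ U ∣ᵛ multiplicity-second-moment)) ⟩
      ∣ Γ ∣ * (∣ U ∣ᵛ * pairEnergy Γ')
        ≡⟨ *-left-swap ∣ Γ ∣ ∣ U ∣ᵛ (pairEnergy Γ') ⟩
      ∣ U ∣ᵛ * (∣ Γ ∣ * pairEnergy Γ')
        ≤⟨ *-monoʳ-≤ ∣ U ∣ᵛ (pairEnergy-bound Γ' Γ'⊆Γ*) ⟩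
      ∣ U ∣ᵛ * (∣ Γ' ∣ * E (k + 1) Γ* Q) ∎
      where open ≤-Reasoning

  -- For the constant family Q^(y) = Q^k, y ∈ Z, the mass is |Z| |Q|^k; cancelling
  -- one factor |Z| gives  |Z| |Γ| |Q|^{2k} ≤ |⋃_{z ∈ Z} (Q^k + Δ(z))| · E_{k+1}(Γ*, Q).
  power-union-bound : ∀ Z → Z ⊆ Γ* → Nonempty Z →
    ∣ Z ∣ * (∣ Γ ∣ * ∣ Q ∣ ^ (2 * k)) ≤ ∣ unionShift Sign.+ Z (λ _ → allB {k} Q) ∣ᵛ * E (k + 1) Γ* Q
  power-union-bound Z Z⊆Γ* Z≢∅ = *-cancelˡ-≤ ∣ Z ∣ {{>-nonZero (card-pos Z Z≢∅)}} (begin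
    ∣ Z ∣ * (∣ Z ∣ * (∣ Γ ∣ * ∣ Q ∣ ^ (2 * k)))
      ≡⟨ cong (λ t → ∣ Z ∣ * (∣ Z ∣ * (∣ Γ ∣ * t))) (^-double ∣ Q ∣) ⟩
    ∣ Z ∣ * (∣ Z ∣ * (∣ Γ ∣ * (∣ Q ∣ ^ k * ∣ Q ∣ ^ k)))
      ≡⟨ regroup ∣ Z ∣ ∣ Γ ∣ (∣ Q ∣ ^ k) ⟩
    ∣ Γ ∣ * (∣ Z ∣ * ∣ Q ∣ ^ k) ^ 2
      ≡⟨ cong (λ t → ∣ Γ ∣ * t ^ 2) (sym constant-mass) ⟩
    ∣ Γ ∣ * mass Z Z⊆Γ* constant Q^k⊆Q^k Sign.+ ^ 2
      ≤⟨ union-bound Z Z⊆Γ* constant Q^k⊆Q^k Sign.+ ⟩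
    ∣ Uᵏ ∣ᵛ * (∣ Z ∣ * E (k + 1) Γ* Q)
      ≡⟨ *-left-swap ∣ Uᵏ ∣ᵛ ∣ Z ∣ _ ⟩
    ∣ Z ∣ * (∣ Uᵏ ∣ᵛ * E (k + 1) Γ* Q) ∎)
    where
      open ≤-Reasoning
      constant : F → VSubset k
      constant _ = allB Q
      Uᵏ : VSubset k
      Uᵏ = unionShift Sign.+ Z constant
      Q^k⊆Q^k : ∀ y → Z y ≡ true → constant y ⊆Pow Q
      Q^k⊆Q^k _ _ = allB-sound Q
      constant-mass : ΣF (λ y → if Z y then ∣ constant y ∣ᵛ else 0) ≡ ∣ Z ∣ * ∣ Q ∣ ^ k
      constant-mass = trans (ΣF-if Z _) (cong (∣ Z ∣ *_) (ΣV-power k Q))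
      ^-double : ∀ q → q ^ (2 * k) ≡ q ^ k * q ^ k
      ^-double q = trans (cong (q ^_) (cong (k +_) (+-identityʳ k))) (^-distribˡ-+-* q k k)
      regroup : ∀ z g p → z * (z * (g * (p * p))) ≡ g * ((z * p) * ((z * p) * 1))
      regroup = solve-∀

corollary45 : (𝔽 : FiniteField) → let open FF 𝔽 in
    (Γ : Subset) → IsMulSubgroup Γ → (ξ : F) → ¬ (ξ ≡ 0#) →
    (Q : Subset) → Nonempty Q → GammaInvariant Γ Q →
    ((Γ' : Subset) → Γ' ⊆ scale ξ Γ → Nonempty Γ' →
       ∣ Γ' ∣ * (∣ Γ ∣ * ∣ Q ∣ ^ 2) ≤ ∣ Q ⊕ Γ' ∣ * E 2 (scale ξ Γ) Q)
    × ((k : ℕ) → 1 ≤ k → (Γ' : Subset) → Γ' ⊆ scale ξ Γ → Nonempty Γ' →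
       (Qf : F → VSubset k) → (∀ y → Γ' y ≡ true → Qf y ⊆Pow Q) → (s : Sign) →
       ∣ Γ ∣ * ΣF (λ y → if Γ' y then ∣ Qf y ∣ᵛ else 0) ^ 2
         ≤ ∣ unionShift s Γ' Qf ∣ᵛ * (∣ Γ' ∣ * E (k + 1) (scale ξ Γ) Q))
    × ((k : ℕ) → 2 ≤ k → (Z : Subset) → Z ⊆ scale ξ Γ → Nonempty Z →
       ∣ Z ∣ * (∣ Γ ∣ * ∣ Q ∣ ^ (2 * k)) ≤ ∣ powPlusΔ k Q Z ∣ᵛ * E (k + 1) (scale ξ Γ) Q)
corollary45 𝔽 Γ Γ-subgroup ξ ξ≢0 Q _ Q-invariant = sumset-bound , family-bound , diagonal-bound
  where
    open FieldSums 𝔽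
    module Union = TranslateUnion 𝔽 Γ Γ-subgroup ξ ξ≢0 Q Q-invariant

    -- Case k = 1 of the diagonal bound, where the union of translates is Q + Γ'.
    sumset-bound : (Γ' : Subset) → Γ' ⊆ scale ξ Γ → Nonempty Γ' →
                   ∣ Γ' ∣ * (∣ Γ ∣ * ∣ Q ∣ ^ 2) ≤ ∣ Q ⊕ Γ' ∣ * E 2 (scale ξ Γ) Q
    sumset-bound Γ' Γ'⊆Γ* Γ'≢∅ =
      ≤-trans (Union.power-union-bound 1 Γ' Γ'⊆Γ* Γ'≢∅)
              (≤-reflexive (cong (_* E 2 (scale ξ Γ) Q) (sumset-as-union Q Γ')))

    family-bound : (k : ℕ) → 1 ≤ k → (Γ' : Subset) → Γ' ⊆ scale ξ Γ → Nonempty Γ' →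
      (Qf : F → VSubset k) → (∀ y → Γ' y ≡ true → Qf y ⊆Pow Q) → (s : Sign) →
      ∣ Γ ∣ * ΣF (λ y → if Γ' y then ∣ Qf y ∣ᵛ else 0) ^ 2
        ≤ ∣ unionShift s Γ' Qf ∣ᵛ * (∣ Γ' ∣ * E (k + 1) (scale ξ Γ) Q)
    family-bound k _ Γ' Γ'⊆Γ* _ = Union.union-bound k Γ' Γ'⊆Γ*

    -- R^{(k)}_Q[Γ*] bound: the union of translates of Q^k is Q^k + Δ(Z).
    diagonal-bound : (k : ℕ) → 2 ≤ k → (Z : Subset) → Z ⊆ scale ξ Γ → Nonempty Z →
      ∣ Z ∣ * (∣ Γ ∣ * ∣ Q ∣ ^ (2 * k)) ≤ ∣ powPlusΔ k Q Z ∣ᵛ * E (k + 1) (scale ξ Γ) Q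
    diagonal-bound k _ Z Z⊆Γ* Z≢∅ =
      ≤-trans (Union.power-union-bound k Z Z⊆Γ* Z≢∅)
              (≤-reflexive (cong (_* E (k + 1) (scale ξ Γ) Q) (∣∣ᵛ-cong (powPlusΔ-as-union k Q Z))))
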